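{- Let $E$ be a finite set, $\mathcal{L}$ a set of subsets of $E$, and suppose the toggle group $T(\mathcal{L})$ acts transitively on $\mathcal{L}$. Fix a system of blocks for $T(\mathcal{L})$. Let $\rho\in T(\mathcal{L})$ be a product of type 2 toggles. If $\rho$ fixes every element of some block $\mathcal{B}$, then $\rho=1$.
   Context: For $e\in E$, the toggle $\tau_e:\mathcal{L}\to\mathcal{L}$ is defined by $\tau_e(X)=X\triangle\{e\}$ if $X\triangle\{e\}\in\mathcal{L}$, and $\tau_e(X)=X$ otherwise. The toggle group $T(\mathcal{L})$ is the subgroup of the symmetric group on $\mathcal{L}$ generated by $\{\tau_e: e\in E\}$. Convention: every $e\in E$ for which $\tau_e$ is the identity permutation is removed from $E$. A block for $T(\mathcal{L})$ is a subset $\mathcal{B}\subseteq\mathcal{L}$ such that for every $g\in T(\mathcal{L})$ either $g(\mathcal{B})=\mathcal{B}$ or $g(\mathcal{B})\cap\mathcal{B}=\emptyset$; a system of blocks is the partition $\{g(\mathcal{B}):g\in T(\mathcal{L})\}$ of $\mathcal{L}$ for a block $\mathcal{B}$. Relative to the fixed block system, an element $g\in T(\mathcal{L})$ (in particular a toggle) is type 2 if $g(\mathcal{B})=\mathcal{B}$ for every block $\mathcal{B}$ of the system, and type 1 otherwise. -}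

module Defs where

open import Data.Nat using (ℕ)
open import Data.Bool using (Bool; true; false; not; if_then_else_)
open import Data.Fin using (Fin)
open import Data.Fin.Subset using (Subset)
open import Data.Vec using (_[_]%=_)
open import Data.List using (List; []; _∷_)
open import Data.List.Relation.Unary.All using (All)
open import Data.Product using (Σ; ∃; _×_; _,_)
open import Data.Sum using (_⊎_)
open import Relation.Nullary using (¬_)
open import Relation.Binary.PropositionalEquality using (_≡_)

Family : ℕ → Set
Family n = Subset n → Bool

_∈𝓛_ : {n : ℕ} → Subset n → Family n → Set
X ∈𝓛 𝓛 = 𝓛 X ≡ true

flipAt : {n : ℕ} → Fin n → Subset n → Subset n
flipAt e X = X [ e ]%= not

toggle : {n : ℕ} → Family n → Fin n → Subset n → Subset n
toggle 𝓛 e X = if 𝓛 (flipAt e X) then flipAt e X else X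

-- Elements of the toggle group T(𝓛) are represented by words in the
-- toggles (each toggle is an involution on 𝓛, so words suffice).
-- act (e ∷ w) = τ_e ∘ act w.
act : {n : ℕ} → Family n → List (Fin n) → Subset n → Subset n
act 𝓛 []      X = X
act 𝓛 (e ∷ w) X = toggle 𝓛 e (act 𝓛 w X)

Transitive : {n : ℕ} → Family n → Set
Transitive {n} 𝓛 = (X Y : Subset n) → X ∈𝓛 𝓛 → Y ∈𝓛 𝓛 →
  Σ (List (Fin n)) λ w → act 𝓛 w X ≡ Y

Coll : ℕ → Set₁
Coll n = Subset n → Set

image : {n : ℕ} → Family n → List (Fin n) → Coll n → Coll n
image {n} 𝓛 g 𝓑 X = Σ (Subset n) λ Y → 𝓑 Y × act 𝓛 g Y ≡ X

SameColl : {n : ℕ} → Coll n → Coll n → Set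
SameColl {n} 𝓐 𝓑 = (X : Subset n) → (𝓐 X → 𝓑 X) × (𝓑 X → 𝓐 X)

DisjointColl : {n : ℕ} → Coll n → Coll n → Set
DisjointColl {n} 𝓐 𝓑 = (X : Subset n) → ¬ (𝓐 X × 𝓑 X)

IsBlock : {n : ℕ} → Family n → Coll n → Set
IsBlock {n} 𝓛 𝓑 =
  ((X : Subset n) → 𝓑 X → X ∈𝓛 𝓛) ×
  (∃ λ X → 𝓑 X) ×
  ((g : List (Fin n)) →
     SameColl (image 𝓛 g 𝓑) 𝓑 ⊎ DisjointColl (image 𝓛 g 𝓑) 𝓑)

-- The system of blocks generated by the block 𝓑₀ is {g(𝓑₀) : g ∈ T(𝓛)}.
-- A toggle τ_e is type 2 (relative to this system) if it stabilises
-- every block g(𝓑₀) of the system.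
Type2Toggle : {n : ℕ} → Family n → Coll n → Fin n → Set
Type2Toggle {n} 𝓛 𝓑₀ e = (g : List (Fin n)) →
  SameColl (image 𝓛 (e ∷ []) (image 𝓛 g 𝓑₀)) (image 𝓛 g 𝓑₀)

-- Call Z ∈ g(𝓑₀) exiting along f if Z △ {f} ∈ 𝓛 but Z △ {f} ∉ g(𝓑₀).  A type 2
-- toggle τ_e maps sets exiting along f to such sets and commutes with △ {f} on
-- them.  Hence if ρ fixes g(𝓑₀) pointwise, it fixes τ_f g(𝓑₀) pointwise: for
-- exiting Z, ρ(Z △ {f}) = ρ(Z) △ {f} = Z △ {f}, and every other element of
-- τ_f g(𝓑₀) already lies in g(𝓑₀).  By transitivity every block is reached from
-- g(𝓑₀) by a sequence of toggles.
module Submission where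

open import Defs
open import Data.Nat using (ℕ)
open import Data.Bool using (true; false; _≟_)
open import Data.Bool.Properties using (not-involutive)
open import Data.Fin using (Fin) renaming (_≟_ to _≟ᶠ_)
open import Data.Fin.Subset using (Subset)
open import Data.List using (List; []; _∷_; _++_; reverse; [_])
open import Data.List.Properties using (reverse-involutive; unfold-reverse)
open import Data.List.Relation.Unary.All using (All; []; _∷_)
open import Data.Product using (Σ; _,_; proj₁; proj₂)
open import Data.Sum using (inj₁; inj₂)
open import Data.Vec.Properties
  using (≡-dec; updateAt-id-local; updateAt-updateAt; updateAt-commutes)
open import Data.Empty using (⊥-elim)
open import Relation.Nullary using (¬_; yes; no; contradiction)
open import Relation.Nullary.Decidable using (decidable-stable)
open import Relation.Binary.PropositionalEquality hiding ([_])

flipAt-involutive : {n : ℕ} (e : Fin n) (X : Subset n) → flipAt e (flipAt e X) ≡ X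
flipAt-involutive e X =
  trans (updateAt-updateAt e X) (updateAt-id-local e X (not-involutive _))

flipAt-comm : {n : ℕ} (e f : Fin n) (X : Subset n) →
              flipAt e (flipAt f X) ≡ flipAt f (flipAt e X)
flipAt-comm e f X with e ≟ᶠ f
... | yes refl = refl
... | no e≢f   = updateAt-commutes e f e≢f X

module Toggles {n : ℕ} (𝓛 : Family n) where

  toggle-flips : ∀ {e X} → flipAt e X ∈𝓛 𝓛 → toggle 𝓛 e X ≡ flipAt e X
  toggle-flips eX rewrite eX = refl

  toggle-stays : ∀ {e X} → 𝓛 (flipAt e X) ≡ false → toggle 𝓛 e X ≡ X
  toggle-stays eX rewrite eX = refl

  toggle-∈ : ∀ {e X} → X ∈𝓛 𝓛 → toggle 𝓛 e X ∈𝓛 𝓛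
  toggle-∈ {e} {X} X∈𝓛 with 𝓛 (flipAt e X) in eX
  ... | true  = eX
  ... | false = X∈𝓛

  toggle-involutive : ∀ {e X} → X ∈𝓛 𝓛 → toggle 𝓛 e (toggle 𝓛 e X) ≡ X
  toggle-involutive {e} {X} X∈𝓛 with 𝓛 (flipAt e X) in eX
  ... | true  = trans (toggle-flips (subst (_∈𝓛 𝓛) (sym (flipAt-involutive e X)) X∈𝓛))
                      (flipAt-involutive e X)
  ... | false = toggle-stays eX

  act-∈ : ∀ w {X} → X ∈𝓛 𝓛 → act 𝓛 w X ∈𝓛 𝓛
  act-∈ []      X∈𝓛 = X∈𝓛
  act-∈ (e ∷ w) X∈𝓛 = toggle-∈ (act-∈ w X∈𝓛)

  act-++ : ∀ u v X → act 𝓛 (u ++ v) X ≡ act 𝓛 u (act 𝓛 v X)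
  act-++ []      v X = refl
  act-++ (e ∷ u) v X = cong (toggle 𝓛 e) (act-++ u v X)

  act-reverse-cancelˡ : ∀ w {X} → X ∈𝓛 𝓛 → act 𝓛 (reverse w) (act 𝓛 w X) ≡ X
  act-reverse-cancelˡ []      X∈𝓛 = refl
  act-reverse-cancelˡ (e ∷ w) {X} X∈𝓛 = begin
    act 𝓛 (reverse (e ∷ w)) (toggle 𝓛 e (act 𝓛 w X))
      ≡⟨ cong (λ u → act 𝓛 u (toggle 𝓛 e (act 𝓛 w X))) (unfold-reverse e w) ⟩
    act 𝓛 (reverse w ++ [ e ]) (toggle 𝓛 e (act 𝓛 w X))
      ≡⟨ act-++ (reverse w) [ e ] _ ⟩
    act 𝓛 (reverse w) (toggle 𝓛 e (toggle 𝓛 e (act 𝓛 w X)))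
      ≡⟨ cong (act 𝓛 (reverse w)) (toggle-involutive (act-∈ w X∈𝓛)) ⟩
    act 𝓛 (reverse w) (act 𝓛 w X)
      ≡⟨ act-reverse-cancelˡ w X∈𝓛 ⟩
    X ∎
    where open ≡-Reasoning

  act-reverse-cancelʳ : ∀ w {X} → X ∈𝓛 𝓛 → act 𝓛 w (act 𝓛 (reverse w) X) ≡ X
  act-reverse-cancelʳ w {X} X∈𝓛 =
    subst (λ u → act 𝓛 u (act 𝓛 (reverse w) X) ≡ X)
          (reverse-involutive w) (act-reverse-cancelˡ (reverse w) X∈𝓛)

  act-conjugate : ∀ w k X →
                  act 𝓛 (reverse w ++ k ++ w) X ≡ act 𝓛 (reverse w) (act 𝓛 k (act 𝓛 w X))
  act-conjugate w k X =
    trans (act-++ (reverse w) (k ++ w) X) (cong (act 𝓛 (reverse w)) (act-++ k w X))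

module Blocks {n : ℕ} (𝓛 : Family n) (𝓑₀ : Coll n) (isBlock : IsBlock 𝓛 𝓑₀) where

  open Toggles 𝓛

  𝓑 : List (Fin n) → Coll n
  𝓑 w = image 𝓛 w 𝓑₀

  𝓑-⊆-𝓛 : ∀ w {X} → 𝓑 w X → X ∈𝓛 𝓛
  𝓑-⊆-𝓛 w (Y , Y∈𝓑₀ , refl) = act-∈ w (proj₁ isBlock Y Y∈𝓑₀)

  𝓑-toggle : ∀ f w {Z} → 𝓑 w Z → 𝓑 (f ∷ w) (toggle 𝓛 f Z)
  𝓑-toggle f w (Y , Y∈𝓑₀ , eq) = Y , Y∈𝓑₀ , cong (toggle 𝓛 _) eq

  -- g(𝓑₀) is again a block: conjugate k by g and use the block property of 𝓑₀.
  𝓑-act-stable : ∀ k w {Z₀ Z} → 𝓑 w Z₀ → 𝓑 w (act 𝓛 k Z₀) → 𝓑 w Z → 𝓑 w (act 𝓛 k Z)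
  𝓑-act-stable k w (Y₀ , Y₀∈𝓑₀ , refl) (Y₁ , Y₁∈𝓑₀ , wY₁≡kwY₀) (Y , Y∈𝓑₀ , refl)
    with proj₂ (proj₂ isBlock) (reverse w ++ k ++ w)
  ... | inj₂ disjoint = ⊥-elim (disjoint Y₁ ((Y₀ , Y₀∈𝓑₀ , conjugate-Y₀) , Y₁∈𝓑₀))
    where
    conjugate-Y₀ : act 𝓛 (reverse w ++ k ++ w) Y₀ ≡ Y₁
    conjugate-Y₀ = begin
      act 𝓛 (reverse w ++ k ++ w) Y₀            ≡⟨ act-conjugate w k Y₀ ⟩
      act 𝓛 (reverse w) (act 𝓛 k (act 𝓛 w Y₀))  ≡⟨ cong (act 𝓛 (reverse w)) wY₁≡kwY₀ ⟨
      act 𝓛 (reverse w) (act 𝓛 w Y₁)            ≡⟨ act-reverse-cancelˡ w (proj₁ isBlock Y₁ Y₁∈𝓑₀) ⟩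
      Y₁                                        ∎
      where open ≡-Reasoning
  ... | inj₁ same = act 𝓛 c Y , proj₁ (same (act 𝓛 c Y)) (Y , Y∈𝓑₀ , refl) , back
    where
    c = reverse w ++ k ++ w
    back : act 𝓛 w (act 𝓛 c Y) ≡ act 𝓛 k (act 𝓛 w Y)
    back = trans (cong (act 𝓛 w) (act-conjugate w k Y))
                 (act-reverse-cancelʳ w (act-∈ k (𝓑-⊆-𝓛 w (Y , Y∈𝓑₀ , refl))))

  type2-preserves : ∀ {e} → Type2Toggle 𝓛 𝓑₀ e → ∀ w {Z} → 𝓑 w Z → 𝓑 w (toggle 𝓛 e Z)
  type2-preserves t2 w {Z} Z∈𝓑 = proj₁ (t2 w _) (Z , Z∈𝓑 , refl)

  type2-reflects : ∀ {e} → Type2Toggle 𝓛 𝓑₀ e → ∀ w {Z} → Z ∈𝓛 𝓛 →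
                   𝓑 w (toggle 𝓛 e Z) → 𝓑 w Z
  type2-reflects t2 w Z∈𝓛 eZ∈𝓑 =
    subst (𝓑 w) (toggle-involutive Z∈𝓛) (type2-preserves t2 w eZ∈𝓑)

  record Exits (f : Fin n) (w : List (Fin n)) (Z : Subset n) : Set where
    field
      inBlock : 𝓑 w Z
      flip-∈  : flipAt f Z ∈𝓛 𝓛
      flip-∉  : ¬ 𝓑 w (flipAt f Z)
  open Exits

  -- τ_f would meet the block g(𝓑₀) in Z △ {e} without stabilising it.
  type2-flip-∈⇒flip-flip-∈ : ∀ {e f w Z} → Type2Toggle 𝓛 𝓑₀ e → Exits f w Z →
                             flipAt e Z ∈𝓛 𝓛 → flipAt e (flipAt f Z) ∈𝓛 𝓛
  type2-flip-∈⇒flip-flip-∈ {e} {f} {w} {Z} t2 ex eZ∈𝓛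
    with 𝓛 (flipAt e (flipAt f Z)) in efZ
  ... | true  = refl
  ... | false = ⊥-elim (flip-∉ ex (subst (𝓑 w) (toggle-flips (flip-∈ ex)) fZ∈𝓑))
    where
    eZ∈𝓑 : 𝓑 w (flipAt e Z)
    eZ∈𝓑 = subst (𝓑 w) (toggle-flips eZ∈𝓛) (type2-preserves t2 w (inBlock ex))
    feZ≡eZ : toggle 𝓛 f (flipAt e Z) ≡ flipAt e Z
    feZ≡eZ = toggle-stays (trans (cong 𝓛 (flipAt-comm f e Z)) efZ)
    fZ∈𝓑 : 𝓑 w (toggle 𝓛 f Z)
    fZ∈𝓑 = 𝓑-act-stable [ f ] w eZ∈𝓑 (subst (𝓑 w) (sym feZ≡eZ) eZ∈𝓑) (inBlock ex)

  -- τ_e stabilises the block τ_f g(𝓑₀), so Z △ {f} △ {e} = τ_f Z′ with Z′ ∈ g(𝓑₀);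
  -- either Z △ {f} ∈ g(𝓑₀) after all, or Z′ = Z △ {e}.
  type2-flip-flip-∈⇒flip-∈ : ∀ {e f w Z} → Type2Toggle 𝓛 𝓑₀ e → Exits f w Z →
                             flipAt e (flipAt f Z) ∈𝓛 𝓛 → flipAt e Z ∈𝓛 𝓛
  type2-flip-flip-∈⇒flip-∈ {e} {f} {w} {Z} t2 ex efZ∈𝓛
    with type2-preserves t2 (f ∷ w) (𝓑-toggle f w (inBlock ex))
  ... | Y , Y∈𝓑₀ , fZ′≡efZ with 𝓛 (flipAt f (act 𝓛 w Y))
  ...   | true  = subst (_∈𝓛 𝓛) Z′≡eZ (𝓑-⊆-𝓛 w (Y , Y∈𝓑₀ , refl))
    where
    Z′≡eZ : act 𝓛 w Y ≡ flipAt e Z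
    Z′≡eZ = begin
      act 𝓛 w Y                         ≡⟨ flipAt-involutive f _ ⟨
      flipAt f (flipAt f (act 𝓛 w Y))   ≡⟨ cong (flipAt f) fZ′≡efZ ⟩
      flipAt f (toggle 𝓛 e (toggle 𝓛 f Z))
        ≡⟨ cong (λ X → flipAt f (toggle 𝓛 e X)) (toggle-flips (flip-∈ ex)) ⟩
      flipAt f (toggle 𝓛 e (flipAt f Z)) ≡⟨ cong (flipAt f) (toggle-flips efZ∈𝓛) ⟩
      flipAt f (flipAt e (flipAt f Z))  ≡⟨ cong (flipAt f) (flipAt-comm e f Z) ⟩
      flipAt f (flipAt f (flipAt e Z))  ≡⟨ flipAt-involutive f _ ⟩
      flipAt e Z                        ∎
      where open ≡-Reasoning
  ...   | false = ⊥-elim (flip-∉ ex (subst (𝓑 w) (toggle-flips (flip-∈ ex)) fZ∈𝓑))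
    where
    fZ∈𝓑 : 𝓑 w (toggle 𝓛 f Z)
    fZ∈𝓑 = type2-reflects t2 w (toggle-∈ (𝓑-⊆-𝓛 w (inBlock ex)))
             (Y , Y∈𝓑₀ , fZ′≡efZ)

  type2-flip-comm : ∀ {e f w Z} → Type2Toggle 𝓛 𝓑₀ e → Exits f w Z →
                    toggle 𝓛 e (flipAt f Z) ≡ flipAt f (toggle 𝓛 e Z)
  type2-flip-comm {e} {f} {w} {Z} t2 ex
    with 𝓛 (flipAt e Z) in eZ | 𝓛 (flipAt e (flipAt f Z)) in efZ
  ... | true  | true  = flipAt-comm e f Z
  ... | false | false = refl
  ... | true  | false = contradiction (trans (sym (type2-flip-∈⇒flip-flip-∈ t2 ex eZ)) efZ) λ ()
  ... | false | true  = contradiction (trans (sym (type2-flip-flip-∈⇒flip-∈ t2 ex efZ)) eZ) λ ()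

  type2-exits : ∀ {e f w Z} → Type2Toggle 𝓛 𝓑₀ e → Exits f w Z → Exits f w (toggle 𝓛 e Z)
  type2-exits {w = w} t2 ex = record
    { inBlock = type2-preserves t2 w (inBlock ex)
    ; flip-∈  = subst (_∈𝓛 𝓛) (type2-flip-comm t2 ex) (toggle-∈ (flip-∈ ex))
    ; flip-∉  = λ fe∈𝓑 → flip-∉ ex (type2-reflects t2 w (flip-∈ ex)
                  (subst (𝓑 w) (sym (type2-flip-comm t2 ex)) fe∈𝓑))
    }

  type2s-exits : ∀ {ρ f w Z} → All (Type2Toggle 𝓛 𝓑₀) ρ → Exits f w Z →
                 Exits f w (act 𝓛 ρ Z)
  type2s-exits []         ex = ex
  type2s-exits (t2 ∷ t2s) ex = type2-exits t2 (type2s-exits t2s ex)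

  type2s-flip-comm : ∀ {ρ f w Z} → All (Type2Toggle 𝓛 𝓑₀) ρ → Exits f w Z →
                     act 𝓛 ρ (flipAt f Z) ≡ flipAt f (act 𝓛 ρ Z)
  type2s-flip-comm []                   ex = refl
  type2s-flip-comm {e ∷ ρ} (t2 ∷ t2s) ex =
    trans (cong (toggle 𝓛 e) (type2s-flip-comm t2s ex))
          (type2-flip-comm t2 (type2s-exits t2s ex))

  FixesBlock : List (Fin n) → List (Fin n) → Set
  FixesBlock ρ w = ∀ X → 𝓑 w X → act 𝓛 ρ X ≡ X

  -- Membership in a block is not decidable, but equality of subsets is, so it
  -- suffices to refute that ρ moves Z △ {f}; if it does, Z exits along f.
  type2s-fixes-toggled-block : ∀ {ρ} → All (Type2Toggle 𝓛 𝓑₀) ρ →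
                               ∀ f w → FixesBlock ρ w → FixesBlock ρ (f ∷ w)
  type2s-fixes-toggled-block {ρ} t2s f w fixes ._ (Y , Y∈𝓑₀ , refl)
    with 𝓛 (flipAt f (act 𝓛 w Y)) in fZ∈𝓛
  ... | false = fixes _ (Y , Y∈𝓑₀ , refl)
  ... | true  = decidable-stable (≡-dec _≟_ _ _) λ moved →
    moved (trans (type2s-flip-comm t2s (exits moved)) (cong (flipAt f) (fixes _ Z∈𝓑)))
    where
    Z∈𝓑 : 𝓑 w (act 𝓛 w Y)
    Z∈𝓑 = Y , Y∈𝓑₀ , refl
    exits : act 𝓛 ρ (flipAt f (act 𝓛 w Y)) ≢ flipAt f (act 𝓛 w Y) → Exits f w (act 𝓛 w Y)
    exits moved = record
      { inBlock = Z∈𝓑 ; flip-∈ = fZ∈𝓛 ; flip-∉ = λ fZ∈𝓑 → moved (fixes _ fZ∈𝓑) }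

  type2s-fixes-block-++ : ∀ {ρ} → All (Type2Toggle 𝓛 𝓑₀) ρ →
                          ∀ g → FixesBlock ρ g → ∀ h → FixesBlock ρ (h ++ g)
  type2s-fixes-block-++ t2s g fixes []      = fixes
  type2s-fixes-block-++ t2s g fixes (f ∷ h) =
    type2s-fixes-toggled-block t2s f (h ++ g) (type2s-fixes-block-++ t2s g fixes h)

lemma2p3 : (n : ℕ) (𝓛 : Family n) → Transitive 𝓛 →
    (𝓑₀ : Coll n) → IsBlock 𝓛 𝓑₀ →
    (ρ : List (Fin n)) → All (Type2Toggle 𝓛 𝓑₀) ρ →
    (Σ (List (Fin n)) λ g →
       (X : Subset n) → image 𝓛 g 𝓑₀ X → act 𝓛 ρ X ≡ X) →
    (X : Subset n) → X ∈𝓛 𝓛 → act 𝓛 ρ X ≡ X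
lemma2p3 n 𝓛 transitive 𝓑₀ isBlock ρ t2s (g , fixes) X X∈𝓛 =
  type2s-fixes-block-++ t2s g fixes h X (Y₀ , Y₀∈𝓑₀ , trans (act-++ h g Y₀) hgY₀≡X)
  where
  open Toggles 𝓛
  open Blocks 𝓛 𝓑₀ isBlock
  Y₀ = proj₁ (proj₁ (proj₂ isBlock))
  Y₀∈𝓑₀ = proj₂ (proj₁ (proj₂ isBlock))
  gY₀↝X = transitive (act 𝓛 g Y₀) X (𝓑-⊆-𝓛 g (Y₀ , Y₀∈𝓑₀ , refl)) X∈𝓛
  h = proj₁ gY₀↝X
  hgY₀≡X = proj₂ gY₀↝X
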